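{- For every integer $n>1$, \[ CP_{(1,1)}(n,X,Y)=\frac{1-X_{n-1}X_{n}Y_{n-1}Y_{n}}{(1-X_{n}Y_{n-1})(1-X_{n-1}Y_{n})(1-X_{n}Y_{n})}\, CP_{(1,1)}(n-1,X,Y). \]
   Context: Let $x_1,x_2,\dots,y_1,y_2,\dots$ be formal variables, $X_i:=x_1x_2\cdots x_i$, $Y_i:=y_1\cdots y_i$. For $n\ge1$, $CP_{(1,1)}(n,X,Y):=\sum \prod_{i=1}^n x_i^{a_i}y_i^{b_i}$, the sum over all tuples of nonnegative integers $(a_1,\dots,a_n,b_1,\dots,b_n)$ with $a_1\ge a_2\ge\dots\ge a_n$, $b_1\ge\dots\ge b_n$, $a_j\ge b_{j+1}$ and $b_j\ge a_{j+1}$ for all $j\ge1$, where $a_j=b_j=0$ for $j>n$. (These are the cylindric partitions with profile $(1,1)$ whose two rows $(a_j)$, $(b_j)$ have at most $n$ nonzero entries.) -}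

module Defs where

open import Data.Nat using (ℕ; zero; suc; _+_; _*_; _∸_; _<ᵇ_; _≤ᵇ_)
open import Data.Bool using (Bool; true; false; _∧_; if_then_else_)
open import Data.Fin using (Fin; toℕ; fromℕ<)
import Data.Fin as F
open import Data.Integer using (ℤ) renaming (_+_ to _+ℤ_; _-_ to _-ℤ_; +_ to ℤ+_)
open import Data.Nat using (_<?_)
open import Relation.Nullary using (yes; no)
open import Data.Product using (_×_; _,_; proj₁; proj₂)

-- Exponent vectors in the n variables x₁..xₙ (resp. y₁..yₙ):
-- index j : Fin n stands for the variable x_{j+1} (resp. y_{j+1}).
Exp : ℕ → Set
Exp n = Fin n → ℕ

-- A formal power series in x₁..xₙ, y₁..yₙ with integer coefficients,
-- given by its coefficient function: (exponents of x) → (exponents of y) → ℤ.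
Series : ℕ → Set
Series n = Exp n → Exp n → ℤ

Mono : ℕ → Set
Mono n = Exp n × Exp n

monoMul : ∀ {n} → Mono n → Mono n → Mono n
monoMul (a , b) (c , d) = (λ j → a j + c j) , (λ j → b j + d j)

-- X_i = x₁⋯x_i (as an x-exponent vector), likewise Y_i.
prefixExp : ∀ {n} → ℕ → Exp n
prefixExp i j = if toℕ j <ᵇ i then 1 else 0

zeroExp : ∀ {n} → Exp n
zeroExp _ = 0

Xm : ∀ {n} → ℕ → Mono n
Xm i = prefixExp i , zeroExp

Ym : ∀ {n} → ℕ → Mono n
Ym i = zeroExp , prefixExp i

leB : ∀ {n} → Exp n → Exp n → Bool
leB {zero}  u v = true
leB {suc n} u v = (u F.zero ≤ᵇ v F.zero) ∧ leB (λ j → u (F.suc j)) (λ j → v (F.suc j))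

sumExp : ∀ {n} → Exp n → ℕ
sumExp {zero}  u = 0
sumExp {suc n} u = u F.zero + sumExp (λ j → u (F.suc j))

shiftCoeff : ∀ {n} → Series n → Mono n → ℕ → Exp n → Exp n → ℤ
shiftCoeff f (a , b) k ea eb =
  if leB (λ j → k * a j) ea ∧ leB (λ j → k * b j) eb
  then f (λ j → ea j ∸ k * a j) (λ j → eb j ∸ k * b j)
  else ℤ+ 0

mulOneMinus : ∀ {n} → Mono n → Series n → Series n
mulOneMinus m f ea eb = f ea eb -ℤ shiftCoeff f m 1 ea eb

-- f / (1 - m) = (Σ_{k≥0} m^k) · f ; for a non-constant monomial m only
-- k ≤ total degree of (ea,eb) can contribute, so the sum is finite.
sumUpTo : ℕ → (ℕ → ℤ) → ℤ
sumUpTo zero    g = g 0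
sumUpTo (suc K) g = sumUpTo K g +ℤ g (suc K)

divOneMinus : ∀ {n} → Mono n → Series n → Series n
divOneMinus m f ea eb = sumUpTo (sumExp ea + sumExp eb) (λ k → shiftCoeff f m k ea eb)

ext : ∀ {n} → Exp n → ℕ → ℕ
ext {n} a j with j <? n
... | yes p = a (fromℕ< p)
... | no  _ = 0

allBelow : ℕ → (ℕ → Bool) → Bool
allBelow zero    P = true
allBelow (suc K) P = allBelow K P ∧ P K

-- (a,b) (0-indexed: a j = a_{j+1}) is a cylindric partition of profile (1,1)
-- with rows having at most k nonzero entries, where a_j = b_j = 0 beyond n:
-- a_j ≥ a_{j+1}, b_j ≥ b_{j+1}, a_j ≥ b_{j+1}, b_j ≥ a_{j+1} for all j ≥ 1,
-- and a_j = b_j = 0 for j > k.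
isCP : ∀ {n} → ℕ → Exp n → Exp n → Bool
isCP {n} k a b =
  allBelow n (λ j →
       (ext a (suc j) ≤ᵇ ext a j)
     ∧ (ext b (suc j) ≤ᵇ ext b j)
     ∧ (ext b (suc j) ≤ᵇ ext a j)
     ∧ (ext a (suc j) ≤ᵇ ext b j)
     ∧ (if j <ᵇ k then true else ((ext a j ≤ᵇ 0) ∧ (ext b j ≤ᵇ 0))))

-- CP_{(1,1)}(k, X, Y) viewed as a series in the variables x₁..xₙ, y₁..yₙ (k ≤ n):
-- the coefficient of x^a y^b is the number of such cylindric partitions with
-- exponent (a,b), i.e. 1 if (a,b) is one and 0 otherwise.
CP : (k n : ℕ) → Series n
CP k n a b = if isCP k a b then ℤ+ 1 else ℤ+ 0

{-# OPTIONS --safe #-}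
module Submission where

-- Split the columns of the two rows into the body (columns 1, …, n-1) and the last column.  Both
-- CP(n-1) and CP(n) have the form [the body is interlaced] · w(α, β, ℓ) for a weight w of the last
-- entries α = a_n, β = b_n and the floor ℓ = min(a_{n-1}, b_{n-1}): w = [α = β = 0], respectively
-- w = [α, β ≤ ℓ].  Each of the four monomials is X_{n-1}Y_{n-1} or its square times a monomial in
-- x_n, y_n, so it lowers all body entries by the same amount; that preserves interlacing, hence
-- multiplying or dividing by 1 - m keeps this form and acts on the weight alone.  Dividing
-- [α = β = 0] by 1 - X_nY_n, 1 - X_{n-1}Y_n and 1 - X_nY_{n-1} gives in turn [α = β ≤ ℓ],
-- [α ≤ β ≤ ℓ] and the number of p with α ∸ β ≤ p ≤ α and p + β ≤ ℓ.  That count is [α, β ≤ ℓ]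
-- plus the same count at (α - 1, β - 1, ℓ - 2), i.e. it is [α, β ≤ ℓ] divided by
-- 1 - X_{n-1}X_nY_{n-1}Y_n.

open import Defs
open import Data.Nat using (ℕ; _≤_; _∸_)
open import Relation.Binary.PropositionalEquality using (_≡_)
open import Data.Nat
open import Data.Nat.Properties
open import Data.Bool using (Bool; true; false; _∧_; if_then_else_; T)
open import Data.Bool.Properties using (∧-assoc; ∧-identityʳ; T-∧; if-float; if-eta; if-∧)
open import Data.Fin using (toℕ; fromℕ<)
import Data.Fin as F
open import Data.Fin.Properties using (toℕ-fromℕ<; toℕ<n)
open import Data.Integer using (ℤ) renaming (_+_ to _+ℤ_; _-_ to _-ℤ_; +_ to ℤ+_)
open import Data.Integer.Properties using ([+m]-[+n]≡m⊖n; ⊖-≥)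
open import Data.Product using (_×_; _,_; proj₁; proj₂)
open import Data.Sum using (inj₁; inj₂)
open import Function using (_⇔_; mk⇔; Equivalence; _∘_; case_of_)
open import Function.Properties.Equivalence using () renaming (trans to ⇔-trans)
open import Data.Product.Function.NonDependent.Propositional using (_×-⇔_)
open import Relation.Nullary using (Dec; yes; no; does; _×-dec_; contradiction)
open import Relation.Nullary.Decidable using (does-⇔; dec-true; dec-false; T?)
open import Relation.Binary.PropositionalEquality

-- Indicators and finite sums

-- does (m ≤? n) reduces to m ≤ᵇ n, so the Boolean tests in isCP and leB are read as `does` of decisions.
𝟙 : {P : Set} → Dec P → ℕ
𝟙 p? = if does p? then 1 else 0

𝟙-cong : {P Q : Set} → P ⇔ Q → (p? : Dec P) (q? : Dec Q) → 𝟙 p? ≡ 𝟙 q?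
𝟙-cong P⇔Q p? q? = cong (if_then 1 else 0) (does-⇔ P⇔Q p? q?)

if-then-𝟙 : {P Q : Set} (p? : Dec P) (q? : Dec Q) → (if does p? then 𝟙 q? else 0) ≡ 𝟙 (p? ×-dec q?)
if-then-𝟙 (yes _) q? = refl
if-then-𝟙 (no _)  q? = refl

T-does : ∀ {A : Set} (a? : Dec A) → T (does a?) ⇔ A
T-does (yes a) = mk⇔ (λ _ → a) _
T-does (no ¬a) = mk⇔ (λ ()) ¬a

if-then-cong : ∀ {A : Set} b {x y z : A} → (T b → x ≡ y) → (if b then x else z) ≡ (if b then y else z)
if-then-cong true  x≡y = x≡y _
if-then-cong false _   = refl

if-+ : ∀ b {c d c′ d′} → (if b then c else d) + (if b then c′ else d′) ≡ (if b then c + c′ else d + d′)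
if-+ true  = refl
if-+ false = refl

∧-assoc⁴ : ∀ a b c d e → (a ∧ b ∧ c ∧ d ∧ e) ≡ ((a ∧ b ∧ c ∧ d) ∧ e)
∧-assoc⁴ false _     _     _ _ = refl
∧-assoc⁴ true  false _     _ _ = refl
∧-assoc⁴ true  true  false _ _ = refl
∧-assoc⁴ true  true  true  _ _ = refl

suc-∸ : ∀ m n → suc m ∸ n ≡ 𝟙 (n ≤? m) + (m ∸ n)
suc-∸ m       zero    = refl
suc-∸ zero    (suc n) = 0∸n≡0 n
suc-∸ (suc m) (suc n) =
  trans (suc-∸ m n) (cong (_+ (m ∸ n)) (𝟙-cong (mk⇔ s≤s s≤s⁻¹) (n ≤? m) (suc n ≤? suc m)))

[+m+n]-[+n]≡+m : ∀ m n → ℤ+ (m + n) -ℤ ℤ+ n ≡ ℤ+ m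
[+m+n]-[+n]≡+m m n = trans ([+m]-[+n]≡m⊖n (m + n) n) (trans (⊖-≥ (m≤n+m n m)) (cong ℤ+_ (m+n∸n≡m m n)))

sumUpToℕ : ℕ → (ℕ → ℕ) → ℕ
sumUpToℕ zero    f = f 0
sumUpToℕ (suc K) f = sumUpToℕ K f + f (suc K)

sumUpToℕ-cong : ∀ K {f g : ℕ → ℕ} → (∀ i → f i ≡ g i) → sumUpToℕ K f ≡ sumUpToℕ K g
sumUpToℕ-cong zero    f≗g = f≗g 0
sumUpToℕ-cong (suc K) f≗g = cong₂ _+_ (sumUpToℕ-cong K f≗g) (f≗g (suc K))

sumUpTo-cong : ∀ K {f g : ℕ → ℤ} → (∀ i → f i ≡ g i) → sumUpTo K f ≡ sumUpTo K g
sumUpTo-cong zero    f≗g = f≗g 0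
sumUpTo-cong (suc K) f≗g = cong₂ _+ℤ_ (sumUpTo-cong K f≗g) (f≗g (suc K))

sumUpTo-ℤ+ : ∀ K (f : ℕ → ℕ) → sumUpTo K (λ i → ℤ+ f i) ≡ ℤ+ sumUpToℕ K f
sumUpTo-ℤ+ zero    f = refl
sumUpTo-ℤ+ (suc K) f = cong (_+ℤ ℤ+ f (suc K)) (sumUpTo-ℤ+ K f)

module _ {f : ℕ → ℕ} where

  sumUpToℕ-zero : ∀ K → (∀ i → i ≤ K → f i ≡ 0) → sumUpToℕ K f ≡ 0
  sumUpToℕ-zero zero    f≡0 = f≡0 0 z≤n
  sumUpToℕ-zero (suc K) f≡0 =
    cong₂ _+_ (sumUpToℕ-zero K (λ i i≤K → f≡0 i (m≤n⇒m≤1+n i≤K))) (f≡0 (suc K) ≤-refl)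

  sumUpToℕ-single : ∀ {i₀} K → i₀ ≤ K → (∀ i → i ≢ i₀ → f i ≡ 0) → sumUpToℕ K f ≡ f i₀
  sumUpToℕ-single zero    z≤n  _   = refl
  sumUpToℕ-single (suc K) i₀≤K f≡0 with m≤n⇒m<n∨m≡n i₀≤K
  ... | inj₁ i₀<1+K = trans
    (cong₂ _+_ (sumUpToℕ-single K (s≤s⁻¹ i₀<1+K) f≡0) (f≡0 (suc K) (>⇒≢ i₀<1+K)))
    (+-identityʳ _)
  ... | inj₂ refl = cong (_+ f (suc K)) (sumUpToℕ-zero K (λ i i≤K → f≡0 i (<⇒≢ (s≤s i≤K))))

  sumUpToℕ-truncate : ∀ {K} K′ → K ≤ K′ → (∀ i → K < i → f i ≡ 0) → sumUpToℕ K′ f ≡ sumUpToℕ K f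
  sumUpToℕ-truncate zero     z≤n    _   = refl
  sumUpToℕ-truncate (suc K′) K≤1+K′ f≡0 with m≤n⇒m<n∨m≡n K≤1+K′
  ... | inj₂ refl   = refl
  ... | inj₁ K<1+K′ = trans
    (cong₂ _+_ (sumUpToℕ-truncate K′ (s≤s⁻¹ K<1+K′) f≡0) (f≡0 (suc K′) K<1+K′))
    (+-identityʳ _)

sumUpToℕ-if : ∀ b K {f : ℕ → ℕ} → sumUpToℕ K (λ i → if b then f i else 0) ≡ (if b then sumUpToℕ K f else 0)
sumUpToℕ-if true  K = refl
sumUpToℕ-if false K = sumUpToℕ-zero K (λ _ _ → refl)

sumUpToℕ-𝟙-single : ∀ {P : ℕ → Set} (P? : ∀ i → Dec (P i)) {i₀ K} {Q : Set} (Q? : Dec Q) →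
                    (∀ i → P i ⇔ (i ≡ i₀ × Q)) → (Q → i₀ ≤ K) → sumUpToℕ K (λ i → 𝟙 (P? i)) ≡ 𝟙 Q?
sumUpToℕ-𝟙-single P? {i₀} {K} (yes q) P⇔ i₀≤K = begin
  sumUpToℕ K (λ i → 𝟙 (P? i)) ≡⟨ sumUpToℕ-single K (i₀≤K q) (λ i i≢i₀ → cong (if_then 1 else 0)
                                     (dec-false (P? i) (i≢i₀ ∘ proj₁ ∘ Equivalence.to (P⇔ i)))) ⟩
  𝟙 (P? i₀)                   ≡⟨ cong (if_then 1 else 0) (dec-true (P? i₀) (Equivalence.from (P⇔ i₀) (refl , q))) ⟩
  1                           ∎
  where open ≡-Reasoning
sumUpToℕ-𝟙-single P? {K = K} (no ¬q) P⇔ _ = sumUpToℕ-zero K (λ i _ → cong (if_then 1 else 0)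
  (dec-false (P? i) (¬q ∘ proj₂ ∘ Equivalence.to (P⇔ i))))

sumUpToℕ-interval : ∀ lo hi K → sumUpToℕ K (λ i → 𝟙 (lo ≤? i ×-dec i <? hi)) ≡ hi ⊓ suc K ∸ lo
sumUpToℕ-interval zero     zero     zero = refl
sumUpToℕ-interval zero     (suc hi) zero = cong suc (sym (⊓-zeroʳ hi))
sumUpToℕ-interval (suc lo) zero     zero = refl
sumUpToℕ-interval (suc lo) (suc hi) zero = sym (trans (cong (_∸ lo) (⊓-zeroʳ hi)) (0∸n≡0 lo))
sumUpToℕ-interval lo hi (suc K) with suc K <? hi
... | yes 1+K<hi = begin
  sumUpToℕ K _ + 𝟙 (lo ≤? suc K ×-dec suc K <? hi)
    ≡⟨ cong₂ _+_ (sumUpToℕ-interval lo hi K)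
                 (𝟙-cong (mk⇔ proj₁ (_, 1+K<hi)) (lo ≤? suc K ×-dec suc K <? hi) (lo ≤? suc K)) ⟩
  hi ⊓ suc K ∸ lo + 𝟙 (lo ≤? suc K) ≡⟨ cong (λ m → m ∸ lo + _) (m≥n⇒m⊓n≡n (<⇒≤ 1+K<hi)) ⟩
  suc K ∸ lo + 𝟙 (lo ≤? suc K)      ≡⟨ +-comm (suc K ∸ lo) _ ⟩
  𝟙 (lo ≤? suc K) + (suc K ∸ lo)    ≡⟨ suc-∸ (suc K) lo ⟨
  suc (suc K) ∸ lo                  ≡⟨ cong (_∸ lo) (m≥n⇒m⊓n≡n 1+K<hi) ⟨
  hi ⊓ suc (suc K) ∸ lo             ∎
  where open ≡-Reasoning
... | no 1+K≮hi = begin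
  sumUpToℕ K _ + 𝟙 (lo ≤? suc K ×-dec suc K <? hi)
    ≡⟨ cong₂ _+_ (sumUpToℕ-interval lo hi K)
                 (cong (if_then 1 else 0) (dec-false (lo ≤? suc K ×-dec suc K <? hi) (1+K≮hi ∘ proj₂))) ⟩
  hi ⊓ suc K ∸ lo + 0               ≡⟨ +-identityʳ _ ⟩
  hi ⊓ suc K ∸ lo                   ≡⟨ cong (_∸ lo) (m≤n⇒m⊓n≡m hi≤1+K) ⟩
  hi ∸ lo                           ≡⟨ cong (_∸ lo) (m≤n⇒m⊓n≡m (m≤n⇒m≤1+n hi≤1+K)) ⟨
  hi ⊓ suc (suc K) ∸ lo             ∎
  where
  open ≡-Reasoning
  hi≤1+K : hi ≤ suc K
  hi≤1+K = ≮⇒≥ 1+K≮hi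

sumUpToℕ-𝟙-interval : ∀ {P : ℕ → Set} (P? : ∀ i → Dec (P i)) {lo hi} K → (∀ i → P i ⇔ (lo ≤ i × i < hi)) →
                      sumUpToℕ K (λ i → 𝟙 (P? i)) ≡ hi ⊓ suc K ∸ lo
sumUpToℕ-𝟙-interval P? {lo} {hi} K P⇔ =
  trans (sumUpToℕ-cong K (λ i → 𝟙-cong (P⇔ i) (P? i) (lo ≤? i ×-dec i <? hi))) (sumUpToℕ-interval lo hi K)

-- Weights

-- A weight is evaluated at α = a_n, β = b_n and ℓ = min(a_{n-1}, b_{n-1}) (see LastColumn.lift).
-- shiftW d d′ c is multiplication by a monomial with exponent c on every body entry of both rows
-- and exponents d, d′ on the last entries.
Weight : Set
Weight = ℕ → ℕ → ℕ → ℕ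

shiftW : (d d′ c : ℕ) → Weight → Weight
shiftW d d′ c w α β ℓ = if does (d ≤? α ×-dec d′ ≤? β ×-dec c ≤? ℓ) then w (α ∸ d) (β ∸ d′) (ℓ ∸ c) else 0

shiftW-vanish : ∀ {d d′ c} w α β {ℓ} → ℓ < c → shiftW d d′ c w α β ℓ ≡ 0
shiftW-vanish {d} {d′} {c} w α β {ℓ} ℓ<c = cong (if_then w (α ∸ d) (β ∸ d′) (ℓ ∸ c) else 0)
  (dec-false (d ≤? α ×-dec d′ ≤? β ×-dec c ≤? ℓ) (λ (_ , _ , c≤ℓ) → <⇒≱ ℓ<c c≤ℓ))

-- Division by 1 - m for m with body exponent 1: the i-th power of m lowers the floor by i, so only
-- i ≤ ℓ contribute.
divW : (d d′ : ℕ) → Weight → Weight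
divW d d′ w α β ℓ = sumUpToℕ ℓ (λ i → shiftW (i * d) (i * d′) i w α β ℓ)

module _ {R : ℕ → ℕ → ℕ → Set} (R? : ∀ α β ℓ → Dec (R α β ℓ)) (d d′ : ℕ) {α β ℓ : ℕ} where

  private
    term? : ∀ i → Dec ((i * d ≤ α × i * d′ ≤ β × i ≤ ℓ) × R (α ∸ i * d) (β ∸ i * d′) (ℓ ∸ i))
    term? i = (i * d ≤? α ×-dec i * d′ ≤? β ×-dec i ≤? ℓ) ×-dec R? (α ∸ i * d) (β ∸ i * d′) (ℓ ∸ i)

    divW-𝟙 : divW d d′ (λ α β ℓ → 𝟙 (R? α β ℓ)) α β ℓ ≡ sumUpToℕ ℓ (λ i → 𝟙 (term? i))
    divW-𝟙 = sumUpToℕ-cong ℓ (λ i →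
      if-then-𝟙 (i * d ≤? α ×-dec i * d′ ≤? β ×-dec i ≤? ℓ) (R? (α ∸ i * d) (β ∸ i * d′) (ℓ ∸ i)))

  divW-𝟙-single : ∀ {i₀} {Q : Set} (Q? : Dec Q) →
    (∀ i → ((i * d ≤ α × i * d′ ≤ β × i ≤ ℓ) × R (α ∸ i * d) (β ∸ i * d′) (ℓ ∸ i)) ⇔ (i ≡ i₀ × Q)) →
    (Q → i₀ ≤ ℓ) → divW d d′ (λ α β ℓ → 𝟙 (R? α β ℓ)) α β ℓ ≡ 𝟙 Q?
  divW-𝟙-single Q? term⇔ i₀≤ℓ = trans divW-𝟙 (sumUpToℕ-𝟙-single term? Q? term⇔ i₀≤ℓ)

  divW-𝟙-interval : ∀ {lo hi} →
    (∀ i → ((i * d ≤ α × i * d′ ≤ β × i ≤ ℓ) × R (α ∸ i * d) (β ∸ i * d′) (ℓ ∸ i)) ⇔ (lo ≤ i × i < hi)) →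
    divW d d′ (λ α β ℓ → 𝟙 (R? α β ℓ)) α β ℓ ≡ hi ⊓ suc ℓ ∸ lo
  divW-𝟙-interval term⇔ = trans divW-𝟙 (sumUpToℕ-𝟙-interval term? ℓ term⇔)

-- tailCount α β ℓ is the number of p with α ∸ β ≤ p ≤ α and p + β ≤ ℓ.
zeroTails equalTails orderedTails boundedTails tailCount : Weight
zeroTails    α β ℓ = 𝟙 (α ≟ 0 ×-dec β ≟ 0)
equalTails   α β ℓ = 𝟙 (α ≟ β ×-dec β ≤? ℓ)
orderedTails α β ℓ = 𝟙 (α ≤? β ×-dec β ≤? ℓ)
boundedTails α β ℓ = 𝟙 (α ≤? ℓ ×-dec β ≤? ℓ)
tailCount    α β ℓ = suc α ⊓ (suc ℓ ∸ β) ∸ (α ∸ β)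

divW-zeroTails : ∀ α β ℓ → divW 1 1 zeroTails α β ℓ ≡ equalTails α β ℓ
divW-zeroTails α β ℓ = divW-𝟙-single (λ α β _ → α ≟ 0 ×-dec β ≟ 0) 1 1
  (α ≟ β ×-dec β ≤? ℓ) term⇔ (λ { (refl , α≤ℓ) → α≤ℓ })
  where
  term⇔ : ∀ i → ((i * 1 ≤ α × i * 1 ≤ β × i ≤ ℓ) × (α ∸ i * 1 ≡ 0 × β ∸ i * 1 ≡ 0))
                 ⇔ (i ≡ α × α ≡ β × β ≤ ℓ)
  term⇔ i rewrite *-identityʳ i = mk⇔
    (λ ((i≤α , i≤β , i≤ℓ) , α∸i≡0 , β∸i≡0) →
      let i≡α = ≤-antisym i≤α (m∸n≡0⇒m≤n α∸i≡0)
          i≡β = ≤-antisym i≤β (m∸n≡0⇒m≤n β∸i≡0)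
      in i≡α , trans (sym i≡α) i≡β , subst (_≤ ℓ) i≡β i≤ℓ)
    (λ { (refl , refl , i≤ℓ) → (≤-refl , ≤-refl , i≤ℓ) , n∸n≡0 i , n∸n≡0 i })

divW-equalTails : ∀ α β ℓ → divW 0 1 equalTails α β ℓ ≡ orderedTails α β ℓ
divW-equalTails α β ℓ = divW-𝟙-single (λ α β ℓ → α ≟ β ×-dec β ≤? ℓ) 0 1
  (α ≤? β ×-dec β ≤? ℓ) term⇔ (λ (_ , β≤ℓ) → ≤-trans (m∸n≤m β α) β≤ℓ)
  where
  term⇔ : ∀ i → ((i * 0 ≤ α × i * 1 ≤ β × i ≤ ℓ) × (α ∸ i * 0 ≡ β ∸ i * 1 × β ∸ i * 1 ≤ ℓ ∸ i))
                 ⇔ (i ≡ β ∸ α × α ≤ β × β ≤ ℓ)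
  term⇔ i rewrite *-zeroʳ i | *-identityʳ i = mk⇔
    (λ ((_ , i≤β , i≤ℓ) , α≡β∸i , β∸i≤ℓ∸i) →
        trans (sym (m∸[m∸n]≡n i≤β)) (cong (β ∸_) (sym α≡β∸i))
      , subst (_≤ β) (sym α≡β∸i) (m∸n≤m β i)
      , subst (_≤ ℓ) (m∸n+n≡m i≤β) (m≤o∸n⇒m+n≤o (β ∸ i) i≤ℓ β∸i≤ℓ∸i))
    (λ (i≡β∸α , α≤β , β≤ℓ) → let i≤β = subst (_≤ β) (sym i≡β∸α) (m∸n≤m β α) in
        (z≤n , i≤β , ≤-trans i≤β β≤ℓ)
      , trans (sym (m∸[m∸n]≡n α≤β)) (cong (β ∸_) (sym i≡β∸α))
      , ∸-monoˡ-≤ i β≤ℓ)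

<1+⊓1+∸⇔ : ∀ {i α β ℓ} → i < suc α ⊓ (suc ℓ ∸ β) ⇔ (i ≤ α × i + β ≤ ℓ)
<1+⊓1+∸⇔ {i} {α} {β} {ℓ} = mk⇔
  (λ i<hi → let 1+i≤1+ℓ∸β = ≤-trans i<hi (m⊓n≤n (suc α) (suc ℓ ∸ β))
                β<1+ℓ = m∸n≢0⇒n<m (λ 1+ℓ∸β≡0 → case subst (suc i ≤_) 1+ℓ∸β≡0 1+i≤1+ℓ∸β of λ ())
            in s≤s⁻¹ (≤-trans i<hi (m⊓n≤m (suc α) _))
             , s≤s⁻¹ (m≤o∸n⇒m+n≤o (suc i) (<⇒≤ β<1+ℓ) 1+i≤1+ℓ∸β))
  (λ (i≤α , i+β≤ℓ) → ⊓-glb (s≤s i≤α) (m+n≤o⇒m≤o∸n (suc i) (s≤s i+β≤ℓ)))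

divW-orderedTails : ∀ α β ℓ → divW 1 0 orderedTails α β ℓ ≡ tailCount α β ℓ
divW-orderedTails α β ℓ = begin
  divW 1 0 orderedTails α β ℓ ≡⟨ divW-𝟙-interval (λ α β ℓ → α ≤? β ×-dec β ≤? ℓ) 1 0 term⇔ ⟩
  hi ⊓ suc ℓ ∸ (α ∸ β)        ≡⟨ cong (_∸ (α ∸ β)) (m≤n⇒m⊓n≡m (≤-trans (m⊓n≤n (suc α) _) (m∸n≤m (suc ℓ) β))) ⟩
  tailCount α β ℓ             ∎
  where
  open ≡-Reasoning
  hi : ℕ
  hi = suc α ⊓ (suc ℓ ∸ β)
  term⇔ : ∀ i → ((i * 1 ≤ α × i * 0 ≤ β × i ≤ ℓ) × (α ∸ i * 1 ≤ β ∸ i * 0 × β ∸ i * 0 ≤ ℓ ∸ i))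
                 ⇔ (α ∸ β ≤ i × i < hi)
  term⇔ i rewrite *-zeroʳ i | *-identityʳ i = mk⇔
    (λ ((i≤α , _ , i≤ℓ) , α∸i≤β , β≤ℓ∸i) →
        m≤n+o⇒m∸n≤o α β (subst (α ≤_) (+-comm i β) (≤-trans (m≤n+m∸n α i) (+-monoʳ-≤ i α∸i≤β)))
      , Equivalence.from <1+⊓1+∸⇔ (i≤α , subst (_≤ ℓ) (+-comm β i) (m≤o∸n⇒m+n≤o β i≤ℓ β≤ℓ∸i)))
    (λ (α∸β≤i , i<hi) → let (i≤α , i+β≤ℓ) = Equivalence.to <1+⊓1+∸⇔ i<hi in
        (i≤α , z≤n , m+n≤o⇒m≤o i i+β≤ℓ)
      , m≤n+o⇒m∸n≤o α i (subst (α ≤_) (+-comm β i) (≤-trans (m≤n+m∸n α β) (+-monoʳ-≤ β α∸β≤i)))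
      , m+n≤o⇒m≤o∸n β (subst (_≤ ℓ) (+-comm i β) i+β≤ℓ))

-- Split off the largest candidate p = α ⊓ (ℓ ∸ β); it is admissible iff α ≤ ℓ.
tailCount-split : ∀ α {β ℓ} → β ≤ ℓ → tailCount α β ℓ ≡ 𝟙 (α ≤? ℓ) + (α ⊓ (ℓ ∸ β) ∸ (α ∸ β))
tailCount-split α {β} {ℓ} β≤ℓ = begin
  suc α ⊓ (suc ℓ ∸ β) ∸ (α ∸ β)         ≡⟨ cong (λ m → suc α ⊓ m ∸ (α ∸ β)) (+-∸-assoc 1 β≤ℓ) ⟩
  suc (α ⊓ (ℓ ∸ β)) ∸ (α ∸ β)            ≡⟨ suc-∸ (α ⊓ (ℓ ∸ β)) (α ∸ β) ⟩
  𝟙 (α ∸ β ≤? α ⊓ (ℓ ∸ β)) + rest        ≡⟨ cong (_+ rest) (𝟙-cong lo≤hi⇔ (α ∸ β ≤? α ⊓ (ℓ ∸ β)) (α ≤? ℓ)) ⟩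
  𝟙 (α ≤? ℓ) + rest                      ∎
  where
  open ≡-Reasoning
  rest : ℕ
  rest = α ⊓ (ℓ ∸ β) ∸ (α ∸ β)
  lo≤hi⇔ : α ∸ β ≤ α ⊓ (ℓ ∸ β) ⇔ α ≤ ℓ
  lo≤hi⇔ = mk⇔
    (λ lo≤hi → subst (α ≤_) (m+[n∸m]≡n β≤ℓ)
                 (≤-trans (m≤n+m∸n α β) (+-monoʳ-≤ β (≤-trans lo≤hi (m⊓n≤n α (ℓ ∸ β))))))
    (λ α≤ℓ → ⊓-glb (m∸n≤m α β) (∸-monoˡ-≤ β α≤ℓ))

tailCount-shift : ∀ α β ℓ → shiftW 1 1 2 tailCount α β ℓ ≡ α ⊓ (ℓ ∸ β) ∸ (α ∸ β)
tailCount-shift zero    β       ℓ             = sym (0∸n≡0 (0 ∸ β))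
tailCount-shift (suc α) zero    ℓ             = sym (m≤n⇒m∸n≡0 (m⊓n≤m (suc α) ℓ))
tailCount-shift (suc α) (suc β) zero          = sym (0∸n≡0 (α ∸ β))
tailCount-shift (suc α) (suc β) (suc zero)    =
  sym (trans (cong (λ m → suc α ⊓ m ∸ (α ∸ β)) (0∸n≡0 β)) (0∸n≡0 (α ∸ β)))
tailCount-shift (suc α) (suc β) (suc (suc ℓ)) = refl

tailCount-step : ∀ α β ℓ → tailCount α β ℓ ≡ boundedTails α β ℓ + shiftW 1 1 2 tailCount α β ℓ
tailCount-step α β ℓ with β ≤? ℓ
... | yes β≤ℓ = begin
  tailCount α β ℓ                                     ≡⟨ tailCount-split α β≤ℓ ⟩
  𝟙 (α ≤? ℓ) + (α ⊓ (ℓ ∸ β) ∸ (α ∸ β))               ≡⟨ cong₂ _+_ bounded≡ (sym (tailCount-shift α β ℓ)) ⟩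
  boundedTails α β ℓ + shiftW 1 1 2 tailCount α β ℓ ∎
  where
  open ≡-Reasoning
  bounded≡ : 𝟙 (α ≤? ℓ) ≡ boundedTails α β ℓ
  bounded≡ = 𝟙-cong (mk⇔ (_, β≤ℓ) proj₁) (α ≤? ℓ) (α ≤? ℓ ×-dec β ≤? ℓ)
... | no β≰ℓ = begin
  tailCount α β ℓ                                     ≡⟨ cong (λ m → suc α ⊓ m ∸ (α ∸ β)) (m≤n⇒m∸n≡0 ℓ<β) ⟩
  suc α ⊓ 0 ∸ (α ∸ β)                                 ≡⟨ ⊓-zeroʳ-∸ (suc α) (α ∸ β) ⟩
  0 + 0                                               ≡⟨ cong₂ _+_ bounded≡0 shift≡0 ⟨
  boundedTails α β ℓ + shiftW 1 1 2 tailCount α β ℓ ∎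
  where
  open ≡-Reasoning
  ℓ<β : ℓ < β
  ℓ<β = ≰⇒> β≰ℓ
  ⊓-zeroʳ-∸ : ∀ m n → m ⊓ 0 ∸ n ≡ 0
  ⊓-zeroʳ-∸ m n = trans (cong (_∸ n) (⊓-zeroʳ m)) (0∸n≡0 n)
  bounded≡0 : boundedTails α β ℓ ≡ 0
  bounded≡0 = cong (if_then 1 else 0) (dec-false (α ≤? ℓ ×-dec β ≤? ℓ) (β≰ℓ ∘ proj₂))
  shift≡0 : shiftW 1 1 2 tailCount α β ℓ ≡ 0
  shift≡0 = trans (tailCount-shift α β ℓ)
    (trans (cong (λ m → α ⊓ m ∸ (α ∸ β)) (m≤n⇒m∸n≡0 (<⇒≤ ℓ<β))) (⊓-zeroʳ-∸ α (α ∸ β)))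


-- Zero extension of exponent vectors

ext-< : ∀ {n} (u : Exp n) {i} (i<n : i < n) → ext u i ≡ u (fromℕ< i<n)
ext-< {n} u {i} i<n with i <? n
... | yes _   = refl
... | no  i≮n = contradiction i<n i≮n

ext-≥ : ∀ {n} (u : Exp n) {i} → n ≤ i → ext u i ≡ 0
ext-≥ {n} u {i} n≤i with i <? n
... | yes i<n = contradiction n≤i (<⇒≱ i<n)
... | no  _   = refl

ext-cong : ∀ {n} {u v : Exp n} → u ≗ v → ∀ i → ext u i ≡ ext v i
ext-cong {n} u≗v i with i <? n
... | yes i<n = u≗v (fromℕ< i<n)
... | no  _   = refl

ext-zipWith : ∀ {n} (f : ℕ → ℕ → ℕ) → f 0 0 ≡ 0 → ∀ (u v : Exp n) i →
              ext (λ j → f (u j) (v j)) i ≡ f (ext u i) (ext v i)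
ext-zipWith {n} f f00≡0 u v i with i <? n
... | yes _ = refl
... | no  _ = sym f00≡0

ext-zero : ∀ {n} (u : Exp (suc n)) → ext u 0 ≡ u F.zero
ext-zero u = ext-< u z<s

ext-suc : ∀ {n} (u : Exp (suc n)) i → ext u (suc i) ≡ ext (u ∘ F.suc) i
ext-suc {n} u i with i <? n
... | yes i<n = ext-< u (s<s i<n)
... | no  i≮n = ext-≥ u (s≤s (≮⇒≥ i≮n))

ext≤sumExp : ∀ {n} (u : Exp n) i → ext u i ≤ sumExp u
ext≤sumExp {zero}  u i       = ≤-reflexive (ext-≥ u {i} z≤n)
ext≤sumExp {suc n} u zero    = ≤-trans (≤-reflexive (ext-zero u)) (m≤m+n _ _)
ext≤sumExp {suc n} u (suc i) = ≤-trans (≤-reflexive (ext-suc u i)) (≤-trans (ext≤sumExp (u ∘ F.suc) i) (m≤n+m _ _))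

allBelow-cong : ∀ K {P Q : ℕ → Bool} → (∀ j → j < K → P j ≡ Q j) → allBelow K P ≡ allBelow K Q
allBelow-cong zero    _   = refl
allBelow-cong (suc K) P≡Q = cong₂ _∧_ (allBelow-cong K (λ j j<K → P≡Q j (m<n⇒m<1+n j<K))) (P≡Q K ≤-refl)

allBelow-suc : ∀ K (P : ℕ → Bool) → allBelow (suc K) P ≡ P 0 ∧ allBelow K (P ∘ suc)
allBelow-suc zero    P = sym (∧-identityʳ (P 0))
allBelow-suc (suc K) P = trans (cong (_∧ P (suc K)) (allBelow-suc K P)) (∧-assoc (P 0) _ _)

T-allBelow : ∀ K {P : ℕ → Bool} → T (allBelow K P) ⇔ (∀ j → j < K → T (P j))
T-allBelow zero    = mk⇔ (λ _ _ ()) _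
T-allBelow (suc K) {P} = mk⇔
  (λ t j j<1+K → let (tK , tP) = Equivalence.to T-∧ t in case m≤n⇒m<n∨m≡n j<1+K of λ
     { (inj₁ j<K)  → Equivalence.to (T-allBelow K) tK j (s≤s⁻¹ j<K)
     ; (inj₂ refl) → tP })
  (λ all → Equivalence.from T-∧ (Equivalence.from (T-allBelow K) (λ j j<K → all j (m<n⇒m<1+n j<K)) , all K ≤-refl))

leB-ext : ∀ {n} (u v : Exp n) → leB u v ≡ allBelow n (λ j → ext u j ≤ᵇ ext v j)
leB-ext {zero}  u v = refl
leB-ext {suc n} u v = begin
  (u F.zero ≤ᵇ v F.zero) ∧ leB (u ∘ F.suc) (v ∘ F.suc)
    ≡⟨ cong₂ _∧_ (sym (cong₂ _≤ᵇ_ (ext-zero u) (ext-zero v))) (leB-ext (u ∘ F.suc) (v ∘ F.suc)) ⟩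
  (ext u 0 ≤ᵇ ext v 0) ∧ allBelow n (λ j → ext (u ∘ F.suc) j ≤ᵇ ext (v ∘ F.suc) j)
    ≡⟨ cong ((ext u 0 ≤ᵇ ext v 0) ∧_) (allBelow-cong n (λ j _ → cong₂ _≤ᵇ_ (ext-suc u j) (ext-suc v j))) ⟨
  (ext u 0 ≤ᵇ ext v 0) ∧ allBelow n (λ j → ext u (suc j) ≤ᵇ ext v (suc j))
    ≡⟨ allBelow-suc n (λ j → ext u j ≤ᵇ ext v j) ⟨
  allBelow (suc n) (λ j → ext u j ≤ᵇ ext v j) ∎
  where open ≡-Reasoning

-- Interlacing

antitone⇒≤ : ∀ {f : ℕ → ℕ} K → (∀ j → j < K → f (suc j) ≤ f j) → ∀ j → j ≤ K → f K ≤ f j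
antitone⇒≤ zero    _    zero z≤n  = ≤-refl
antitone⇒≤ (suc K) step j    j≤1+K with m≤n⇒m<n∨m≡n j≤1+K
... | inj₂ refl   = ≤-refl
... | inj₁ j<1+K = ≤-trans (step K ≤-refl) (antitone⇒≤ K (λ i i<K → step i (m<n⇒m<1+n i<K)) j (s≤s⁻¹ j<1+K))

Interlaced : (a₀ a₁ b₀ b₁ : ℕ) → Set
Interlaced a₀ a₁ b₀ b₁ = a₁ ≤ a₀ × b₁ ≤ b₀ × b₁ ≤ a₀ × a₁ ≤ b₀

interlaced? : ∀ a₀ a₁ b₀ b₁ → Dec (Interlaced a₀ a₁ b₀ b₁)
interlaced? a₀ a₁ b₀ b₁ = a₁ ≤? a₀ ×-dec b₁ ≤? b₀ ×-dec b₁ ≤? a₀ ×-dec a₁ ≤? b₀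

∸-cancelʳ-≤′ : ∀ {c x y} → c ≤ x → c ≤ y → x ∸ c ≤ y ∸ c → x ≤ y
∸-cancelʳ-≤′ {c} {x} {y} c≤x c≤y le = subst (_≤ y) (m∸n+n≡m c≤x) (m≤o∸n⇒m+n≤o (x ∸ c) c≤y le)

Interlaced-∸ : ∀ {c a₀ a₁ b₀ b₁} → c ≤ a₀ → c ≤ a₁ → c ≤ b₀ → c ≤ b₁ →
               Interlaced (a₀ ∸ c) (a₁ ∸ c) (b₀ ∸ c) (b₁ ∸ c) ⇔ Interlaced a₀ a₁ b₀ b₁
Interlaced-∸ {c} ca₀ ca₁ cb₀ cb₁ = mk⇔
  (λ (p , q , r , s) → ∸-cancelʳ-≤′ ca₁ ca₀ p , ∸-cancelʳ-≤′ cb₁ cb₀ q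
                     , ∸-cancelʳ-≤′ cb₁ ca₀ r , ∸-cancelʳ-≤′ ca₁ cb₀ s)
  (λ (p , q , r , s) → ∸-monoˡ-≤ c p , ∸-monoˡ-≤ c q , ∸-monoˡ-≤ c r , ∸-monoˡ-≤ c s)

-- Rows of length n = k + 2, indexed from 0: columns 0, …, k form the body, column k + 1 is the last.
module LastColumn (k : ℕ) where

  n : ℕ
  n = suc (suc k)

  bodyLast : ℕ → ℕ → Exp n
  bodyLast c d j = if toℕ j <ᵇ suc k then c else d

  ext-bodyLast : ∀ c d {i} → i < n → ext (bodyLast c d) i ≡ (if i <ᵇ suc k then c else d)
  ext-bodyLast c d {i} i<n =
    trans (ext-< (bodyLast c d) i<n) (cong (λ m → if m <ᵇ suc k then c else d) (toℕ-fromℕ< i<n))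

  ext-bodyLast-body : ∀ c d {i} → i < suc k → ext (bodyLast c d) i ≡ c
  ext-bodyLast-body c d {i} i<1+k =
    trans (ext-bodyLast c d (m<n⇒m<1+n i<1+k)) (cong (if_then c else d) (dec-true (i <? suc k) i<1+k))

  ext-bodyLast-last : ∀ c d → ext (bodyLast c d) (suc k) ≡ d
  ext-bodyLast-last c d =
    trans (ext-bodyLast c d ≤-refl) (cong (if_then c else d) (dec-false (suc k <? suc k) (n≮n (suc k))))

  prefix-body-row : prefixExp (suc k) ≗ bodyLast 1 0
  prefix-body-row _ = refl

  prefix-full-row : prefixExp n ≗ bodyLast 1 1
  prefix-full-row j = trans (cong (if_then 1 else 0) (dec-true (toℕ j <? n) (toℕ<n j))) (sym (if-eta _))

  zero-row : zeroExp ≗ bodyLast 0 0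
  zero-row _ = sym (if-eta _)

  +-row : ∀ {r r′ c d c′ d′} → r ≗ bodyLast c d → r′ ≗ bodyLast c′ d′ →
          (λ j → r j + r′ j) ≗ bodyLast (c + c′) (d + d′)
  +-row r≗ r′≗ j = trans (cong₂ _+_ (r≗ j) (r′≗ j)) (if-+ (toℕ j <ᵇ suc k))

  *-row : ∀ i {r c d} → r ≗ bodyLast c d → (λ j → i * r j) ≗ bodyLast (i * c) (i * d)
  *-row i r≗ j = trans (cong (i *_) (r≗ j)) (if-float (i *_) _)

  lastEntry : Exp n → ℕ
  lastEntry u = ext u (suc k)

  floor : Exp n → Exp n → ℕ
  floor u v = ext u k ⊓ ext v k

  columnsInterlaced : Exp n → Exp n → ℕ → Bool
  columnsInterlaced u v j = does (interlaced? (ext u j) (ext u (suc j)) (ext v j) (ext v (suc j)))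

  bodyInterlaced : Exp n → Exp n → Bool
  bodyInterlaced u v = allBelow k (columnsInterlaced u v)

  lift : Weight → Series n
  lift w u v = ℤ+ (if bodyInterlaced u v then w (lastEntry u) (lastEntry v) (floor u v) else 0)

  lift-cong : ∀ {w w′} → (∀ α β ℓ → w α β ℓ ≡ w′ α β ℓ) → ∀ u v → lift w u v ≡ lift w′ u v
  lift-cong w≡w′ u v = cong (λ m → ℤ+ (if bodyInterlaced u v then m else 0)) (w≡w′ _ _ _)

  module _ (kk : ℕ) (u v : Exp n) where

    private
      lengthBound : ℕ → Bool
      lengthBound j = if j <ᵇ kk then true else ((ext u j ≤ᵇ 0) ∧ (ext v j ≤ᵇ 0))

      column : ℕ → Bool
      column j = (ext u (suc j) ≤ᵇ ext u j) ∧ (ext v (suc j) ≤ᵇ ext v j) ∧ (ext v (suc j) ≤ᵇ ext u j)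
               ∧ (ext u (suc j) ≤ᵇ ext v j) ∧ lengthBound j

      column-below : ∀ {j} → j < kk → column j ≡ columnsInterlaced u v j
      column-below {j} j<kk = begin
        column j                                ≡⟨ ∧-assoc⁴ (ext u (suc j) ≤ᵇ ext u j) (ext v (suc j) ≤ᵇ ext v j)
                                                            (ext v (suc j) ≤ᵇ ext u j) (ext u (suc j) ≤ᵇ ext v j) _ ⟩
        columnsInterlaced u v j ∧ lengthBound j ≡⟨ cong (λ b → columnsInterlaced u v j ∧ (if b then true else zeros))
                                                        (dec-true (j <? kk) j<kk) ⟩
        columnsInterlaced u v j ∧ true          ≡⟨ ∧-identityʳ _ ⟩
        columnsInterlaced u v j                 ∎
        where
        open ≡-Reasoning
        zeros : Bool
        zeros = (ext u j ≤ᵇ 0) ∧ (ext v j ≤ᵇ 0)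

      column-last : column (suc k) ≡ (if suc k <ᵇ kk then true else ((lastEntry u ≤ᵇ 0) ∧ (lastEntry v ≤ᵇ 0)))
      column-last rewrite ext-≥ u {suc (suc k)} ≤-refl | ext-≥ v {suc (suc k)} ≤-refl = refl

      interlaced-last⇔ : Interlaced (ext u k) (lastEntry u) (ext v k) (lastEntry v)
                         ⇔ (lastEntry u ≤ floor u v × lastEntry v ≤ floor u v)
      interlaced-last⇔ = mk⇔
        (λ (αu , βv , βu , αv) → ⊓-glb αu αv , ⊓-glb βu βv)
        (λ (α≤ℓ , β≤ℓ) → ≤-trans α≤ℓ (m⊓n≤m _ _) , ≤-trans β≤ℓ (m⊓n≤n _ _)
                        , ≤-trans β≤ℓ (m⊓n≤m _ _) , ≤-trans α≤ℓ (m⊓n≤n _ _))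

    isCP-lastColumn : suc k ≤ kk →
      isCP kk u v ≡ (bodyInterlaced u v ∧ does (lastEntry u ≤? floor u v ×-dec lastEntry v ≤? floor u v))
                    ∧ (if suc k <ᵇ kk then true else ((lastEntry u ≤ᵇ 0) ∧ (lastEntry v ≤ᵇ 0)))
    isCP-lastColumn 1+k≤kk = cong₂ _∧_
      (cong₂ _∧_ (allBelow-cong k (λ j j<k → column-below (≤-trans j<k (≤-trans (n≤1+n k) 1+k≤kk))))
                 (trans (column-below 1+k≤kk)
                        (does-⇔ interlaced-last⇔ (interlaced? _ _ _ _) (_ ≤? _ ×-dec _ ≤? _))))
      column-last

  CP≡lift : ∀ kk {Q : ℕ → ℕ → ℕ → Set} (Q? : ∀ α β ℓ → Dec (Q α β ℓ)) →
    (∀ u v → isCP kk u v ≡ bodyInterlaced u v ∧ does (Q? (lastEntry u) (lastEntry v) (floor u v))) →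
    ∀ u v → CP kk n u v ≡ lift (λ α β ℓ → 𝟙 (Q? α β ℓ)) u v
  CP≡lift kk Q? isCP≡ u v = trans (sym (if-float ℤ+_ (isCP kk u v)))
    (cong ℤ+_ (trans (cong (if_then 1 else 0) (isCP≡ u v)) (if-∧ (bodyInterlaced u v))))

  module _ (u v : Exp n) where

    private
      α β ℓ : ℕ
      α = lastEntry u
      β = lastEntry v
      ℓ = floor u v
      B : Bool
      B = bodyInterlaced u v

    isCP-full : isCP n u v ≡ B ∧ does (α ≤? ℓ ×-dec β ≤? ℓ)
    isCP-full = begin
      isCP n u v                                            ≡⟨ isCP-lastColumn n u v (n≤1+n (suc k)) ⟩
      (B ∧ does (α ≤? ℓ ×-dec β ≤? ℓ)) ∧ (if suc k <ᵇ n then true else ((α ≤ᵇ 0) ∧ (β ≤ᵇ 0)))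
        ≡⟨ cong (λ b → (B ∧ does (α ≤? ℓ ×-dec β ≤? ℓ)) ∧ (if b then true else ((α ≤ᵇ 0) ∧ (β ≤ᵇ 0))))
                (dec-true (suc k <? n) ≤-refl) ⟩
      (B ∧ does (α ≤? ℓ ×-dec β ≤? ℓ)) ∧ true               ≡⟨ ∧-identityʳ _ ⟩
      B ∧ does (α ≤? ℓ ×-dec β ≤? ℓ)                        ∎
      where open ≡-Reasoning

    isCP-short : isCP (suc k) u v ≡ B ∧ does (α ≟ 0 ×-dec β ≟ 0)
    isCP-short = begin
      isCP (suc k) u v                                      ≡⟨ isCP-lastColumn (suc k) u v ≤-refl ⟩
      (B ∧ does (α ≤? ℓ ×-dec β ≤? ℓ)) ∧ (if suc k <ᵇ suc k then true else ((α ≤ᵇ 0) ∧ (β ≤ᵇ 0)))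
        ≡⟨ cong (λ b → (B ∧ does (α ≤? ℓ ×-dec β ≤? ℓ)) ∧ (if b then true else ((α ≤ᵇ 0) ∧ (β ≤ᵇ 0))))
                (dec-false (suc k <? suc k) (n≮n (suc k))) ⟩
      (B ∧ does (α ≤? ℓ ×-dec β ≤? ℓ)) ∧ does (α ≤? 0 ×-dec β ≤? 0)
        ≡⟨ ∧-assoc B _ _ ⟩
      B ∧ does ((α ≤? ℓ ×-dec β ≤? ℓ) ×-dec (α ≤? 0 ×-dec β ≤? 0))
        ≡⟨ cong (B ∧_) (does-⇔ zero⇔ ((α ≤? ℓ ×-dec β ≤? ℓ) ×-dec (α ≤? 0 ×-dec β ≤? 0)) (α ≟ 0 ×-dec β ≟ 0)) ⟩
      B ∧ does (α ≟ 0 ×-dec β ≟ 0)                          ∎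
      where
      open ≡-Reasoning
      zero⇔ : ((α ≤ ℓ × β ≤ ℓ) × (α ≤ 0 × β ≤ 0)) ⇔ (α ≡ 0 × β ≡ 0)
      zero⇔ = mk⇔ (λ (_ , α≤0 , β≤0) → n≤0⇒n≡0 α≤0 , n≤0⇒n≡0 β≤0)
                  (λ (α≡0 , β≡0) → (subst (_≤ ℓ) (sym α≡0) z≤n , subst (_≤ ℓ) (sym β≡0) z≤n)
                                 , (≤-reflexive α≡0 , ≤-reflexive β≡0))

  CP-full≡lift : ∀ u v → CP n n u v ≡ lift boundedTails u v
  CP-full≡lift = CP≡lift n (λ α β ℓ → α ≤? ℓ ×-dec β ≤? ℓ) isCP-full

  CP-short≡lift : ∀ u v → CP (suc k) n u v ≡ lift zeroTails u v
  CP-short≡lift = CP≡lift (suc k) (λ α β _ → α ≟ 0 ×-dec β ≟ 0) isCP-short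

  _⊖_ : Exp n → Exp n → Exp n
  (u ⊖ s) j = u j ∸ s j

  BodyAtLeast : ℕ → Exp n → Set
  BodyAtLeast c u = ∀ j → j < suc k → c ≤ ext u j

  module _ {u v : Exp n} (body : T (bodyInterlaced u v)) where

    private
      interlaced : ∀ j → j < k → Interlaced (ext u j) (ext u (suc j)) (ext v j) (ext v (suc j))
      interlaced j j<k = Equivalence.to (T-does (interlaced? _ _ _ _)) (Equivalence.to (T-allBelow k) body j j<k)

    bodyInterlaced-antitone : ∀ j → j < suc k → ext u k ≤ ext u j × ext v k ≤ ext v j
    bodyInterlaced-antitone j j<1+k =
        antitone⇒≤ k (λ i i<k → proj₁ (interlaced i i<k)) j (s≤s⁻¹ j<1+k)
      , antitone⇒≤ k (λ i i<k → proj₁ (proj₂ (interlaced i i<k))) j (s≤s⁻¹ j<1+k)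

    BodyAtLeast⇔ : ∀ {c} → (BodyAtLeast c u × BodyAtLeast c v) ⇔ c ≤ floor u v
    BodyAtLeast⇔ = mk⇔
      (λ (cu , cv) → ⊓-glb (cu k ≤-refl) (cv k ≤-refl))
      (λ c≤ℓ → (λ j j<1+k → ≤-trans (≤-trans c≤ℓ (m⊓n≤m _ _)) (proj₁ (bodyInterlaced-antitone j j<1+k)))
             , (λ j j<1+k → ≤-trans (≤-trans c≤ℓ (m⊓n≤n _ _)) (proj₂ (bodyInterlaced-antitone j j<1+k))))

  module _ {c d : ℕ} {s : Exp n} (s≗ : s ≗ bodyLast c d) where

    ext-⊖-body : ∀ u {i} → i < suc k → ext (u ⊖ s) i ≡ ext u i ∸ c
    ext-⊖-body u {i} i<1+k = trans (ext-zipWith _∸_ refl u s i)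
      (cong (ext u i ∸_) (trans (ext-cong s≗ i) (ext-bodyLast-body c d i<1+k)))

    lastEntry-⊖ : ∀ u → lastEntry (u ⊖ s) ≡ lastEntry u ∸ d
    lastEntry-⊖ u = trans (ext-zipWith _∸_ refl u s (suc k))
      (cong (lastEntry u ∸_) (trans (ext-cong s≗ (suc k)) (ext-bodyLast-last c d)))

    leB-bodyLast : ∀ u → leB s u ≡ allBelow (suc k) (λ j → c ≤ᵇ ext u j) ∧ (d ≤ᵇ lastEntry u)
    leB-bodyLast u = trans (leB-ext s u) (cong₂ _∧_
      (allBelow-cong (suc k) (λ j j<1+k →
        cong (_≤ᵇ ext u j) (trans (ext-cong s≗ j) (ext-bodyLast-body c d j<1+k))))
      (cong (_≤ᵇ lastEntry u) (trans (ext-cong s≗ (suc k)) (ext-bodyLast-last c d))))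

    T-leB-bodyLast : ∀ u → T (leB s u) ⇔ (BodyAtLeast c u × d ≤ lastEntry u)
    T-leB-bodyLast u = mk⇔
      (λ t → let (t₁ , t₂) = Equivalence.to T-∧ (subst T (leB-bodyLast u) t) in
          (λ j j<1+k → ≤ᵇ⇒≤ c (ext u j) (Equivalence.to (T-allBelow (suc k)) t₁ j j<1+k))
        , ≤ᵇ⇒≤ d (lastEntry u) t₂)
      (λ (cu , d≤α) → subst T (sym (leB-bodyLast u)) (Equivalence.from T-∧
          (Equivalence.from (T-allBelow (suc k)) (λ j j<1+k → ≤⇒≤ᵇ (cu j j<1+k)) , ≤⇒≤ᵇ d≤α)))

  module _ {c d d′ : ℕ} {s t : Exp n} (s≗ : s ≗ bodyLast c d) (t≗ : t ≗ bodyLast c d′) where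

    T-leB² : ∀ {u v} → T (leB s u ∧ leB t v)
                       ⇔ ((BodyAtLeast c u × d ≤ lastEntry u) × (BodyAtLeast c v × d′ ≤ lastEntry v))
    T-leB² {u} {v} = ⇔-trans (T-∧ {leB s u}) (T-leB-bodyLast s≗ u ×-⇔ T-leB-bodyLast t≗ v)

    bodyInterlaced-⊖ : ∀ {u v} → BodyAtLeast c u → BodyAtLeast c v →
                       bodyInterlaced (u ⊖ s) (v ⊖ t) ≡ bodyInterlaced u v
    bodyInterlaced-⊖ {u} {v} cu cv = allBelow-cong k column-⊖
      where
      column-⊖ : ∀ j → j < k → columnsInterlaced (u ⊖ s) (v ⊖ t) j ≡ columnsInterlaced u v j
      column-⊖ j j<k
        rewrite ext-⊖-body s≗ u (m<n⇒m<1+n j<k) | ext-⊖-body s≗ u (s≤s j<k)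
              | ext-⊖-body t≗ v (m<n⇒m<1+n j<k) | ext-⊖-body t≗ v (s≤s j<k)
        = does-⇔ (Interlaced-∸ (cu j (m<n⇒m<1+n j<k)) (cu (suc j) (s≤s j<k))
                               (cv j (m<n⇒m<1+n j<k)) (cv (suc j) (s≤s j<k)))
                 (interlaced? _ _ _ _) (interlaced? _ _ _ _)

    floor-⊖ : ∀ u v → floor (u ⊖ s) (v ⊖ t) ≡ floor u v ∸ c
    floor-⊖ u v = trans (cong₂ _⊓_ (ext-⊖-body s≗ u ≤-refl) (ext-⊖-body t≗ v ≤-refl))
                        (sym (∸-distribʳ-⊓ c (ext u k) (ext v k)))

    lift-⊖ : ∀ w {u v} → T (leB s u ∧ leB t v) →
      lift w (u ⊖ s) (v ⊖ t)
        ≡ ℤ+ (if bodyInterlaced u v then w (lastEntry u ∸ d) (lastEntry v ∸ d′) (floor u v ∸ c) else 0)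
    lift-⊖ w {u} {v} fits
      rewrite bodyInterlaced-⊖ (proj₁ (proj₁ (Equivalence.to (T-leB² {u} {v}) fits)))
                               (proj₁ (proj₂ (Equivalence.to (T-leB² {u} {v}) fits)))
            | lastEntry-⊖ s≗ u | lastEntry-⊖ t≗ v | floor-⊖ u v
      = refl

    leB⇔ : ∀ {u v} → T (bodyInterlaced u v) →
           T (leB s u ∧ leB t v) ⇔ (d ≤ lastEntry u × d′ ≤ lastEntry v × c ≤ floor u v)
    leB⇔ body = ⇔-trans T-leB² (mk⇔
      (λ ((cu , d≤α) , (cv , d′≤β)) → d≤α , d′≤β , Equivalence.to (BodyAtLeast⇔ body) (cu , cv))
      (λ (d≤α , d′≤β , c≤ℓ) → let (cu , cv) = Equivalence.from (BodyAtLeast⇔ body) c≤ℓ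
                              in (cu , d≤α) , (cv , d′≤β)))

  shiftCoeff-lift : ∀ {a b : Exp n} {c d d′} i → (λ j → i * a j) ≗ bodyLast c d → (λ j → i * b j) ≗ bodyLast c d′ →
                    ∀ w u v → shiftCoeff (lift w) (a , b) i u v ≡ lift (shiftW d d′ c w) u v
  shiftCoeff-lift {a} {b} {c} {d} {d′} i s≗ t≗ w u v with bodyInterlaced u v in body
  ... | false = begin
    (if fits then X else ℤ+ 0)    ≡⟨ if-then-cong fits (λ fits → trans (lift-⊖ s≗ t≗ w fits)
                                                           (cong (λ b → ℤ+ (if b then W else 0)) body)) ⟩
    (if fits then ℤ+ 0 else ℤ+ 0) ≡⟨ if-eta fits ⟩
    ℤ+ 0                          ∎
    where
    open ≡-Reasoning
    fits : Bool
    fits = leB (λ j → i * a j) u ∧ leB (λ j → i * b j) v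
    X : ℤ
    X = lift w (u ⊖ (λ j → i * a j)) (v ⊖ (λ j → i * b j))
    W : ℕ
    W = w (lastEntry u ∸ d) (lastEntry v ∸ d′) (floor u v ∸ c)
  ... | true = begin
    (if fits then X else ℤ+ 0)           ≡⟨ cong (if_then X else ℤ+ 0) (does-⇔ fits⇔ (T? fits) guard?) ⟩
    (if does guard? then X else ℤ+ 0)    ≡⟨ if-then-cong (does guard?) (λ g →
                                              trans (lift-⊖ s≗ t≗ w (Equivalence.from fits⇔
                                                                      (Equivalence.to (T-does guard?) g)))
                                                    (cong (λ b → ℤ+ (if b then W else 0)) body)) ⟩
    (if does guard? then ℤ+ W else ℤ+ 0) ≡⟨ if-float ℤ+_ (does guard?) ⟨
    ℤ+ (if does guard? then W else 0)    ∎
    where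
    open ≡-Reasoning
    fits : Bool
    fits = leB (λ j → i * a j) u ∧ leB (λ j → i * b j) v
    X : ℤ
    X = lift w (u ⊖ (λ j → i * a j)) (v ⊖ (λ j → i * b j))
    W : ℕ
    W = w (lastEntry u ∸ d) (lastEntry v ∸ d′) (floor u v ∸ c)
    guard? : Dec (d ≤ lastEntry u × d′ ≤ lastEntry v × c ≤ floor u v)
    guard? = d ≤? lastEntry u ×-dec d′ ≤? lastEntry v ×-dec c ≤? floor u v
    fits⇔ : T fits ⇔ (d ≤ lastEntry u × d′ ≤ lastEntry v × c ≤ floor u v)
    fits⇔ = leB⇔ s≗ t≗ (subst T (sym body) _)

  _≗₂_ : Series n → Series n → Set
  f ≗₂ g = ∀ u v → f u v ≡ g u v

  shiftCoeff-cong : ∀ {f g : Series n} → f ≗₂ g → ∀ m i u v → shiftCoeff f m i u v ≡ shiftCoeff g m i u v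
  shiftCoeff-cong f≗g (a , b) i u v =
    cong (λ z → if leB (λ j → i * a j) u ∧ leB (λ j → i * b j) v then z else ℤ+ 0) (f≗g _ _)

  divOneMinus-lift : ∀ {a b : Exp n} {d d′} {f : Series n} {w w′} → a ≗ bodyLast 1 d → b ≗ bodyLast 1 d′ →
                     f ≗₂ lift w → (∀ α β ℓ → divW d d′ w α β ℓ ≡ w′ α β ℓ) → divOneMinus (a , b) f ≗₂ lift w′
  divOneMinus-lift {a} {b} {d} {d′} {f} {w} {w′} a≗ b≗ f≗ divW≡ u v = begin
    sumUpTo D (λ i → shiftCoeff f (a , b) i u v)
      ≡⟨ sumUpTo-cong D (λ i → trans (shiftCoeff-cong f≗ (a , b) i u v)
                                      (shiftCoeff-lift i (power-row a≗ i) (power-row b≗ i) w u v)) ⟩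
    sumUpTo D (λ i → ℤ+ (if B then term i else 0)) ≡⟨ sumUpTo-ℤ+ D _ ⟩
    ℤ+ sumUpToℕ D (λ i → if B then term i else 0)  ≡⟨ cong ℤ+_ (sumUpToℕ-if B D) ⟩
    ℤ+ (if B then sumUpToℕ D term else 0)
      ≡⟨ cong (λ m → ℤ+ (if B then m else 0))
              (sumUpToℕ-truncate D ℓ≤D (λ i → shiftW-vanish {i * d} {i * d′} w (lastEntry u) (lastEntry v))) ⟩
    lift (divW d d′ w) u v                          ≡⟨ lift-cong divW≡ u v ⟩
    lift w′ u v                                     ∎
    where
    open ≡-Reasoning
    D : ℕ
    D = sumExp u + sumExp v
    B : Bool
    B = bodyInterlaced u v
    term : ℕ → ℕ
    term i = shiftW (i * d) (i * d′) i w (lastEntry u) (lastEntry v) (floor u v)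
    ℓ≤D : floor u v ≤ D
    ℓ≤D = ≤-trans (m⊓n≤m _ _) (≤-trans (ext≤sumExp u k) (m≤m+n _ _))
    power-row : ∀ {r e} → r ≗ bodyLast 1 e → ∀ i → (λ j → i * r j) ≗ bodyLast i (i * e)
    power-row {e = e} r≗ i j = trans (*-row i r≗ j) (cong (λ c → bodyLast c (i * e) j) (*-identityʳ i))

  mulOneMinus-lift : ∀ {a b : Exp n} {c d d′} {f : Series n} {w} → a ≗ bodyLast c d → b ≗ bodyLast c d′ →
                     f ≗₂ lift w → ∀ u v → mulOneMinus (a , b) f u v ≡ lift w u v -ℤ lift (shiftW d d′ c w) u v
  mulOneMinus-lift {a} {b} {w = w} a≗ b≗ f≗ u v = cong₂ _-ℤ_ (f≗ u v)
    (trans (shiftCoeff-cong f≗ (a , b) 1 u v) (shiftCoeff-lift 1 (unit-row a≗) (unit-row b≗) w u v))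
    where
    unit-row : ∀ {r c d} → r ≗ bodyLast c d → (λ j → 1 * r j) ≗ bodyLast c d
    unit-row r≗ j = trans (*-identityˡ _) (r≗ j)

  lift-∸ : ∀ {w} w₀ w₁ → (∀ α β ℓ → w α β ℓ ≡ w₀ α β ℓ + w₁ α β ℓ) →
           ∀ u v → lift w u v -ℤ lift w₁ u v ≡ lift w₀ u v
  lift-∸ w₀ w₁ w≡ u v with bodyInterlaced u v
  ... | false = refl
  ... | true  = trans (cong (λ m → ℤ+ m -ℤ ℤ+ w₁ α β ℓ) (w≡ α β ℓ)) ([+m+n]-[+n]≡+m (w₀ α β ℓ) (w₁ α β ℓ))
    where
    α β ℓ : ℕ
    α = lastEntry u
    β = lastEntry v
    ℓ = floor u v

theorem3p1 : (n : ℕ) → 2 ≤ n → (a b : Exp n) →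
    CP n n a b
      ≡ mulOneMinus (monoMul (monoMul (Xm (n ∸ 1)) (Xm n)) (monoMul (Ym (n ∸ 1)) (Ym n)))
          (divOneMinus (monoMul (Xm n) (Ym (n ∸ 1)))
            (divOneMinus (monoMul (Xm (n ∸ 1)) (Ym n))
              (divOneMinus (monoMul (Xm n) (Ym n))
                (CP (n ∸ 1) n)))) a b
theorem3p1 (suc (suc k)) _ a b = begin
  CP n n a b
    ≡⟨ CP-full≡lift a b ⟩
  lift boundedTails a b
    ≡⟨ lift-∸ boundedTails (shiftW 1 1 2 tailCount) tailCount-step a b ⟨
  lift tailCount a b -ℤ lift (shiftW 1 1 2 tailCount) a b
    ≡⟨ mulOneMinus-lift {w = tailCount} x-row y-row quotient a b ⟨
  mulOneMinus (monoMul (monoMul (Xm (suc k)) (Xm n)) (monoMul (Ym (suc k)) (Ym n))) series a b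
    ∎
  where
  open ≡-Reasoning
  open LastColumn k
  x-row : (λ j → (prefixExp (suc k) j + prefixExp n j) + (zeroExp j + zeroExp j)) ≗ bodyLast 2 1
  x-row = +-row (+-row prefix-body-row prefix-full-row) (+-row zero-row zero-row)
  y-row : (λ j → (zeroExp j + zeroExp j) + (prefixExp (suc k) j + prefixExp n j)) ≗ bodyLast 2 1
  y-row = +-row (+-row zero-row zero-row) (+-row prefix-body-row prefix-full-row)
  series : Series n
  series = divOneMinus (monoMul (Xm n) (Ym (suc k)))
             (divOneMinus (monoMul (Xm (suc k)) (Ym n))
               (divOneMinus (monoMul (Xm n) (Ym n))
                 (CP (suc k) n)))
  quotient : series ≗₂ lift tailCount
  quotient =
    divOneMinus-lift {w = orderedTails} (+-row prefix-full-row zero-row) (+-row zero-row prefix-body-row)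
      (divOneMinus-lift {w = equalTails} (+-row prefix-body-row zero-row) (+-row zero-row prefix-full-row)
        (divOneMinus-lift {w = zeroTails} (+-row prefix-full-row zero-row) (+-row zero-row prefix-full-row)
          CP-short≡lift divW-zeroTails)
        divW-equalTails)
      divW-orderedTails
theorem3p1 (suc zero) (s≤s ()) a b
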